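{- The 4-cube graph $Q_4$ has a 1-factorization $\mathcal{F}=\{F_1,F_2,F_3,F_4\}$ (a partition of its edge set into four perfect matchings) such that every 4-cycle of $Q_4$ is rainbow, i.e., its four edges belong to four different 1-factors of $\mathcal{F}$, giving a one-to-one correspondence between the four edges of the 4-cycle and the four 1-factors.
   Context: $Q_4$ is the graph with vertex set $\{0,1\}^4$, two vertices adjacent iff they differ in exactly one coordinate. -}

module Defs where

open import Data.Nat using (ℕ; zero; suc; _+_)
open import Data.Bool using (Bool; true; false; _≟_)
open import Data.Vec using (Vec; []; _∷_)
open import Data.Fin using (Fin)
open import Data.Product using (_×_; ∃!)
open import Relation.Nullary using (¬_; yes; no)
open import Relation.Binary.PropositionalEquality using (_≡_)

Vertex : Set
Vertex = Vec Bool 4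

hamming : ∀ {n} → Vec Bool n → Vec Bool n → ℕ
hamming [] [] = zero
hamming (x ∷ xs) (y ∷ ys) with x ≟ y
... | yes _ = hamming xs ys
... | no _ = suc (hamming xs ys)

Adj : Vertex → Vertex → Set
Adj u v = hamming u v ≡ 1

-- An edge colouring with four colours, given as a function on ordered pairs of
-- vertices; only its values on adjacent pairs matter.  Colour class i is F_i.
Colouring : Set
Colouring = Vertex → Vertex → Fin 4

-- c is a 1-factorization {F_1,..,F_4}: c is well defined on (unordered) edges,
-- so every edge lies in exactly one F_i (partition of the edge set), and each
-- F_i is a perfect matching: every vertex u is covered by exactly one edge of F_i.
record IsOneFactorization (c : Colouring) : Set where
  field
    symmetric : ∀ u v → Adj u v → c u v ≡ c v u
    perfect   : ∀ (i : Fin 4) (u : Vertex) → ∃! _≡_ (λ v → Adj u v × c u v ≡ i)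

record IsFourCycle (v0 v1 v2 v3 : Vertex) : Set where
  field
    a01 : Adj v0 v1
    a12 : Adj v1 v2
    a23 : Adj v2 v3
    a30 : Adj v3 v0
    d01 : ¬ v0 ≡ v1
    d02 : ¬ v0 ≡ v2
    d03 : ¬ v0 ≡ v3
    d12 : ¬ v1 ≡ v2
    d13 : ¬ v1 ≡ v3
    d23 : ¬ v2 ≡ v3

record IsRainbow (c : Colouring) (v0 v1 v2 v3 : Vertex) : Set where
  private
    e0 = c v0 v1
    e1 = c v1 v2
    e2 = c v2 v3
    e3 = c v3 v0
  field
    n01 : ¬ e0 ≡ e1
    n02 : ¬ e0 ≡ e2
    n03 : ¬ e0 ≡ e3
    n12 : ¬ e1 ≡ e2
    n13 : ¬ e1 ≡ e3
    n23 : ¬ e2 ≡ e3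

-- Identify the four directions of Q₄ and the four colours with the field
-- GF(4) = {0, 1, ω, ω²}, and colour the edge {u, u + e_d} by
-- (1 + ω·|u|)·d + ω·Σ_{u_k = 1} k, where |u| ∈ {0, 1} is the parity of u.
-- Crossing the edge toggles |u| and adds d to the sum, and since 1 + ω = ω²
-- both endpoints give the same colour.  At a fixed vertex the colour is an
-- invertible affine function of d, so each colour class is a perfect
-- matching.  Every 4-cycle of a cube is a square u, u + e_i, u + e_i + e_j,
-- u + e_j with i ≠ j, and a computation in GF(4) shows that its four edges
-- get four different colours.
module Submission where

open import Defs
open import Data.Bool using (Bool; true; false; not; _xor_)
import Data.Bool as Bool
open import Data.Bool.Properties
  using (not-¬; ¬-not; not-involutive; not-distribˡ-xor; not-distribʳ-xor)
open import Data.Empty using (⊥; ⊥-elim)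
open import Data.Fin using (Fin; zero; suc; _≟_)
open import Data.Fin.Properties using (all?)
open import Data.List using (List; []; _∷_)
open import Data.List.Relation.Unary.All using ([]; _∷_)
open import Data.List.Relation.Unary.AllPairs using ([]; _∷_)
open import Data.List.Relation.Unary.Unique.DecPropositional (_≟_ {4}) using (Unique; unique?)
open import Data.Nat using (suc)
open import Data.Nat.Properties using (suc-injective)
open import Data.Product using (Σ; ∃; ∃!; _×_; _,_)
import Data.Product as Product
open import Data.Vec using (Vec; []; _∷_; lookup; allFin; _[_]%=_)
open import Data.Vec.Properties
  using (lookup∘updateAt; lookup∘updateAt′; updateAt-updateAt; updateAt-id-local;
         updateAt-commutes; lookup-allFin)
open import Function using (_∘_)
open import Relation.Nullary using (Dec; yes; no; contradiction)
open import Relation.Nullary.Decidable using (from-yes; ¬?; _→-dec_)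
open import Relation.Binary.PropositionalEquality
  using (_≡_; _≢_; refl; sym; trans; cong; cong₂; subst; ≢-sym; module ≡-Reasoning)
open ≡-Reasoning

flipAt : ∀ {n} → Fin n → Vec Bool n → Vec Bool n
flipAt i u = u [ i ]%= not

flipAt-involutive : ∀ {n} (i : Fin n) u → flipAt i (flipAt i u) ≡ u
flipAt-involutive i u =
  trans (updateAt-updateAt i u) (updateAt-id-local i u (not-involutive _))

flipAt-comm : ∀ {n} {i j : Fin n} → i ≢ j → ∀ u → flipAt i (flipAt j u) ≡ flipAt j (flipAt i u)
flipAt-comm {i = i} {j} = updateAt-commutes i j

lookup-flipAt : ∀ {n} (i : Fin n) u → lookup (flipAt i u) i ≡ not (lookup u i)
lookup-flipAt i u = lookup∘updateAt i u

lookup-flipAt-≢ : ∀ {n} {i m : Fin n} → i ≢ m → ∀ u → lookup (flipAt i u) m ≡ lookup u m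
lookup-flipAt-≢ {i = i} {m} i≢m u = lookup∘updateAt′ m i (≢-sym i≢m) u

hamming-refl : ∀ {n} (u : Vec Bool n) → hamming u u ≡ 0
hamming-refl [] = refl
hamming-refl (x ∷ xs) with x Bool.≟ x
... | yes _   = hamming-refl xs
... | no x≢x = contradiction refl x≢x

hamming≡0⇒≡ : ∀ {n} (u v : Vec Bool n) → hamming u v ≡ 0 → u ≡ v
hamming≡0⇒≡ [] [] _ = refl
hamming≡0⇒≡ (x ∷ xs) (y ∷ ys) h with x Bool.≟ y
... | yes refl = cong (x ∷_) (hamming≡0⇒≡ xs ys h)

hamming-flipAt : ∀ {n} (i : Fin n) u → hamming u (flipAt i u) ≡ 1
hamming-flipAt zero (x ∷ xs) with x Bool.≟ not x
... | yes x≡¬x = contradiction x≡¬x (not-¬ refl)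
... | no _     = cong suc (hamming-refl xs)
hamming-flipAt (suc i) (x ∷ xs) with x Bool.≟ x
... | yes _   = hamming-flipAt i xs
... | no x≢x = contradiction refl x≢x

hamming≡1⇒flipAt : ∀ {n} (u v : Vec Bool n) → hamming u v ≡ 1 → ∃ λ i → v ≡ flipAt i u
hamming≡1⇒flipAt [] [] ()
hamming≡1⇒flipAt (x ∷ xs) (y ∷ ys) h with x Bool.≟ y
... | yes refl = Product.map suc (cong (x ∷_)) (hamming≡1⇒flipAt xs ys h)
... | no x≢y   = zero , cong₂ _∷_ (¬-not (≢-sym x≢y)) (sym (hamming≡0⇒≡ xs ys (suc-injective h)))

flipAt-walk-retraces : ∀ {n} {i j k l : Fin n} (u : Vec Bool n) → i ≢ j → j ≢ k →
                       flipAt l (flipAt k (flipAt j (flipAt i u))) ≡ u → k ≡ i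
flipAt-walk-retraces {i = i} {j} {k} {l} u i≢j j≢k closed with k ≟ i
... | yes k≡i = k≡i
... | no k≢i  = ⊥-elim (toggled (l ≟ j))
  where
  w₁ = flipAt i u
  w₂ = flipAt j w₁
  w₃ = flipAt k w₂

  -- some coordinate is flipped exactly once along the walk
  toggled : Dec (l ≡ j) → ⊥
  toggled (no l≢j) = not-¬ refl (trans (sym (cong (λ v → lookup v j) closed)) (begin
    lookup (flipAt l w₃) j ≡⟨ lookup-flipAt-≢ l≢j w₃ ⟩
    lookup w₃ j            ≡⟨ lookup-flipAt-≢ (≢-sym j≢k) w₂ ⟩
    lookup w₂ j            ≡⟨ lookup-flipAt j w₁ ⟩
    not (lookup w₁ j)      ≡⟨ cong not (lookup-flipAt-≢ i≢j u) ⟩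
    not (lookup u j)       ∎))
  toggled (yes refl) = not-¬ refl (trans (sym (cong (λ v → lookup v i) closed)) (begin
    lookup (flipAt j w₃) i ≡⟨ lookup-flipAt-≢ (≢-sym i≢j) w₃ ⟩
    lookup w₃ i            ≡⟨ lookup-flipAt-≢ k≢i w₂ ⟩
    lookup w₂ i            ≡⟨ lookup-flipAt-≢ (≢-sym i≢j) w₁ ⟩
    lookup w₁ i            ≡⟨ lookup-flipAt i u ⟩
    not (lookup u i)       ∎))

data Square {n} : (v0 v1 v2 v3 : Vec Bool n) → Set where
  square : ∀ {i j} u → i ≢ j → Square u (flipAt i u) (flipAt j (flipAt i u)) (flipAt j u)

four-cycle⇒square : ∀ {v0 v1 v2 v3} → IsFourCycle v0 v1 v2 v3 → Square v0 v1 v2 v3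
four-cycle⇒square {v0} {v1} {v2} {v3} cyc
  with hamming≡1⇒flipAt v0 v1 (IsFourCycle.a01 cyc) | hamming≡1⇒flipAt v1 v2 (IsFourCycle.a12 cyc)
     | hamming≡1⇒flipAt v2 v3 (IsFourCycle.a23 cyc) | hamming≡1⇒flipAt v3 v0 (IsFourCycle.a30 cyc)
... | i , refl | j , refl | k , refl | l , closed =
  subst (Square v0 (flipAt i v0) (flipAt j (flipAt i v0))) opposite (square v0 i≢j)
  where
  i≢j : i ≢ j
  i≢j refl = IsFourCycle.d02 cyc (sym (flipAt-involutive i v0))
  j≢k : j ≢ k
  j≢k refl = IsFourCycle.d13 cyc (sym (flipAt-involutive j (flipAt i v0)))
  opposite : flipAt j v0 ≡ flipAt k (flipAt j (flipAt i v0))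
  opposite rewrite flipAt-walk-retraces v0 i≢j j≢k (sym closed) =
    sym (trans (flipAt-comm i≢j _) (cong (flipAt j) (flipAt-involutive i v0)))

𝔽₄ : Set
𝔽₄ = Fin 4

pattern 0# = zero
pattern 1# = suc zero
pattern ω  = suc (suc zero)
pattern ω² = suc (suc (suc zero))

infixl 6 _+_
infixr 7 ω·_

_+_ : 𝔽₄ → 𝔽₄ → 𝔽₄
0# + y  = y
1# + 0# = 1#
1# + 1# = 0#
1# + ω  = ω²
1# + ω² = ω
ω  + 0# = ω
ω  + 1# = ω²
ω  + ω  = 0#
ω  + ω² = 1#
ω² + 0# = ω²
ω² + 1# = ω
ω² + ω  = 1#
ω² + ω² = 0#

ω·_ : 𝔽₄ → 𝔽₄
ω· 0# = 0#
ω· 1# = ω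
ω· ω  = ω²
ω· ω² = 1#

+-comm : ∀ x y → x + y ≡ y + x
+-comm = from-yes (all? λ x → all? λ y → x + y ≟ y + x)

+-assoc : ∀ x y z → x + y + z ≡ x + (y + z)
+-assoc = from-yes (all? λ x → all? λ y → all? λ z → x + y + z ≟ x + (y + z))

x+[x+y]≡y : ∀ x y → x + (x + y) ≡ y
x+[x+y]≡y = from-yes (all? λ x → all? λ y → x + (x + y) ≟ y)

[x+y]+x≡y : ∀ x y → x + y + x ≡ y
[x+y]+x≡y x y = trans (+-comm (x + y) x) (x+[x+y]≡y x y)

weigh : ∀ {n} → Vec 𝔽₄ n → Vec Bool n → 𝔽₄
weigh []       []           = 0#
weigh (ℓ ∷ ℓs) (false ∷ xs) = weigh ℓs xs
weigh (ℓ ∷ ℓs) (true  ∷ xs) = ℓ + weigh ℓs xs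

weigh-flipAt : ∀ {n} (ℓs : Vec 𝔽₄ n) i u → weigh ℓs (flipAt i u) ≡ weigh ℓs u + lookup ℓs i
weigh-flipAt (ℓ ∷ ℓs) zero    (false ∷ xs) = +-comm ℓ (weigh ℓs xs)
weigh-flipAt (ℓ ∷ ℓs) zero    (true  ∷ xs) = sym ([x+y]+x≡y ℓ (weigh ℓs xs))
weigh-flipAt (ℓ ∷ ℓs) (suc i) (false ∷ xs) = weigh-flipAt ℓs i xs
weigh-flipAt (ℓ ∷ ℓs) (suc i) (true  ∷ xs) =
  trans (cong (ℓ +_) (weigh-flipAt ℓs i xs)) (sym (+-assoc ℓ _ _))

parity : ∀ {n} → Vec Bool n → Bool
parity []       = false
parity (x ∷ xs) = x xor parity xs

parity-flipAt : ∀ {n} (i : Fin n) u → parity (flipAt i u) ≡ not (parity u)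
parity-flipAt zero    (x ∷ xs) = sym (not-distribˡ-xor x (parity xs))
parity-flipAt (suc i) (x ∷ xs) =
  trans (cong (x xor_) (parity-flipAt i xs)) (sym (not-distribʳ-xor x (parity xs)))

-- Coordinate k of Q₄ is labelled by the element k of 𝔽₄ = Fin 4.
σ : Vertex → 𝔽₄
σ = weigh (allFin 4)

σ-flipAt : ∀ i u → σ (flipAt i u) ≡ σ u + i
σ-flipAt i u = trans (weigh-flipAt (allFin 4) i u) (cong (σ u +_) (lookup-allFin i))

-- multiplication by 1 + ω·p, where 1 + ω = ω²
scale : Bool → 𝔽₄ → 𝔽₄
scale false x = x
scale true  x = ω· ω· x

edgeColour : Bool → 𝔽₄ → 𝔽₄ → 𝔽₄
edgeColour p s d = scale p d + ω· s

-- On adjacent vertices σ u + σ v is the direction of the edge.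
colouring : Colouring
colouring u v = edgeColour (parity u) (σ u) (σ u + σ v)

colouring-flipAtʳ : ∀ d u → colouring u (flipAt d u) ≡ edgeColour (parity u) (σ u) d
colouring-flipAtʳ d u =
  cong (edgeColour (parity u) (σ u)) (trans (cong (σ u +_) (σ-flipAt d u)) (x+[x+y]≡y (σ u) d))

colouring-flipAtˡ : ∀ d u → colouring (flipAt d u) u ≡ edgeColour (not (parity u)) (σ u + d) d
colouring-flipAtˡ d u rewrite parity-flipAt d u | σ-flipAt d u =
  cong (edgeColour (not (parity u)) (σ u + d)) ([x+y]+x≡y (σ u) d)

edgeColour-flip : ∀ p s d → edgeColour p s d ≡ edgeColour (not p) (s + d) d
edgeColour-flip false = from-yes (all? λ s → all? λ d → edgeColour false s d ≟ edgeColour true (s + d) d)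
edgeColour-flip true  = from-yes (all? λ s → all? λ d → edgeColour true s d ≟ edgeColour false (s + d) d)

colouring-symmetric : ∀ u v → Adj u v → colouring u v ≡ colouring v u
colouring-symmetric u v adj with hamming≡1⇒flipAt u v adj
... | d , refl = begin
  colouring u (flipAt d u)                     ≡⟨ colouring-flipAtʳ d u ⟩
  edgeColour (parity u) (σ u) d                ≡⟨ edgeColour-flip (parity u) (σ u) d ⟩
  edgeColour (not (parity u)) (σ u + d) d      ≡⟨ sym (colouring-flipAtˡ d u) ⟩
  colouring (flipAt d u) u                     ∎

direction : Bool → 𝔽₄ → 𝔽₄ → 𝔽₄
direction false s i = i + ω· s
direction true  s i = ω· (i + ω· s)

edgeColour-direction : ∀ p s i → edgeColour p s (direction p s i) ≡ i
edgeColour-direction false = from-yes (all? λ s → all? λ i → edgeColour false s (direction false s i) ≟ i)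
edgeColour-direction true  = from-yes (all? λ s → all? λ i → edgeColour true s (direction true s i) ≟ i)

direction-edgeColour : ∀ p s d → direction p s (edgeColour p s d) ≡ d
direction-edgeColour false = from-yes (all? λ s → all? λ d → direction false s (edgeColour false s d) ≟ d)
direction-edgeColour true  = from-yes (all? λ s → all? λ d → direction true s (edgeColour true s d) ≟ d)

colouring-perfect : ∀ i u → ∃! _≡_ (λ v → Adj u v × colouring u v ≡ i)
colouring-perfect i u =
  flipAt d u , (hamming-flipAt d u , trans (colouring-flipAtʳ d u) (edgeColour-direction p s i)) , unique
  where
  p = parity u
  s = σ u
  d = direction p s i

  unique : ∀ {v} → Adj u v × colouring u v ≡ i → flipAt d u ≡ v
  unique {v} (adj , coloured) with hamming≡1⇒flipAt u v adj
  ... | d′ , refl = cong (λ e → flipAt e u) (begin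
    direction p s i                  ≡⟨ cong (direction p s) (trans (sym coloured) (colouring-flipAtʳ d′ u)) ⟩
    direction p s (edgeColour p s d′) ≡⟨ direction-edgeColour p s d′ ⟩
    d′                               ∎)

colouring-isOneFactorization : IsOneFactorization colouring
colouring-isOneFactorization = record { symmetric = colouring-symmetric ; perfect = colouring-perfect }

rainbow-intro : ∀ {c : Colouring} {v0 v1 v2 v3} →
                Unique (c v0 v1 ∷ c v1 v2 ∷ c v2 v3 ∷ c v3 v0 ∷ []) → IsRainbow c v0 v1 v2 v3
rainbow-intro ((n01 ∷ n02 ∷ n03 ∷ []) ∷ (n12 ∷ n13 ∷ []) ∷ (n23 ∷ []) ∷ [] ∷ []) =
  record { n01 = n01 ; n02 = n02 ; n03 = n03 ; n12 = n12 ; n13 = n13 ; n23 = n23 }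

squareColours : Bool → 𝔽₄ → 𝔽₄ → 𝔽₄ → List 𝔽₄
squareColours p s i j =
  edgeColour p s i ∷ edgeColour (not p) (s + i) j ∷ edgeColour p (s + j + i) i ∷ edgeColour (not p) (s + j) j ∷ []

square-colours-unique : ∀ p s i j → i ≢ j → Unique (squareColours p s i j)
square-colours-unique false =
  from-yes (all? λ s → all? λ i → all? λ j → ¬? (i ≟ j) →-dec unique? (squareColours false s i j))
square-colours-unique true  =
  from-yes (all? λ s → all? λ i → all? λ j → ¬? (i ≟ j) →-dec unique? (squareColours true s i j))

square-rainbow : ∀ {v0 v1 v2 v3} → Square v0 v1 v2 v3 → IsRainbow colouring v0 v1 v2 v3
square-rainbow (square {i} {j} u i≢j) = rainbow-intro colours-unique
  where
  p = parity u
  s = σ u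
  uᵢ = flipAt i u
  uⱼ = flipAt j u

  colour₁ : colouring uᵢ (flipAt j uᵢ) ≡ edgeColour (not p) (s + i) j
  colour₁ = trans (colouring-flipAtʳ j uᵢ)
                  (cong₂ (λ q t → edgeColour q t j) (parity-flipAt i u) (σ-flipAt i u))

  colour₂ : colouring (flipAt j uᵢ) uⱼ ≡ edgeColour p (s + j + i) i
  colour₂ = begin
    colouring (flipAt j uᵢ) uⱼ                  ≡⟨ cong (λ v → colouring v uⱼ) (flipAt-comm (≢-sym i≢j) u) ⟩
    colouring (flipAt i uⱼ) uⱼ                  ≡⟨ colouring-flipAtˡ i uⱼ ⟩
    edgeColour (not (parity uⱼ)) (σ uⱼ + i) i   ≡⟨ cong₂ (λ q t → edgeColour q (t + i) i)
                                                         (trans (cong not (parity-flipAt j u)) (not-involutive p))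
                                                         (σ-flipAt j u) ⟩
    edgeColour p (s + j + i) i                  ∎

  colours-unique : Unique (colouring u uᵢ ∷ colouring uᵢ (flipAt j uᵢ) ∷ colouring (flipAt j uᵢ) uⱼ ∷ colouring uⱼ u ∷ [])
  colours-unique rewrite colouring-flipAtʳ i u | colour₁ | colour₂ | colouring-flipAtˡ j u =
    square-colours-unique p s i j i≢j

theorem6 : Σ Colouring (λ c → IsOneFactorization c
             × (∀ v0 v1 v2 v3 → IsFourCycle v0 v1 v2 v3 → IsRainbow c v0 v1 v2 v3))
theorem6 = colouring , colouring-isOneFactorization , λ _ _ _ _ → square-rainbow ∘ four-cycle⇒square
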